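{- Let $r$ be a positive integer and $m$ a nonnegative integer with $r$-binomial representation $m=\sum_{i=t}^{r}\binom{a_i}{i}$. Then $\kappa_r(m)=\kappa_r^*(m)$ if and only if $a_i\ge 2i-1$ for all $i=t,t+1,\dots,r$.
   Context: Every nonnegative integer $m$ has a unique $r$-binomial representation $m=\sum_{i=t}^{r}\binom{a_i}{i}$ with $a_r>a_{r-1}>\dots>a_t\ge t\ge1$ (empty sum for $m=0$). The Kruskal–Katona function is $\kappa_r(m):=\sum_{i=t}^{r}\binom{a_i}{i-1}-m$ (equal to $|\Delta F_{n,r}(m)|-m$ whenever $m\le\binom nr$, where $F_{n,r}(m)$ is the family of the first $m$ $r$-subsets of $\{1,\dots,n\}$ in squashed order and $\Delta$ is the shadow), and $\kappa_r^*(m):=\min_{0\le j\le m}\kappa_r(j)$. -}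

module Defs where

open import Data.Nat using (ℕ; zero; suc; _+_; _*_; _∸_; _≤_; _<_; _≤?_; _≟_)
open import Data.Nat.Combinatorics using (_C_)
open import Data.Integer as ℤ using (ℤ; +_; _-_; _⊓_)
open import Data.List using (List; []; _∷_; applyUpTo; map)
open import Data.Nat.ListAction using (sum)
open import Data.Product using (_×_; _,_)
open import Relation.Nullary using (yes; no)

sumFromTo : ℕ → ℕ → (ℕ → ℕ) → ℕ
sumFromTo t r f = sum (map f (applyUpTo (λ k → t + k) (suc r ∸ t)))

-- (t , a) is the r-binomial representation of m:
--   m = Σ_{i=t}^{r} C(a_i , i),  a_r > a_{r-1} > ... > a_t ≥ t ≥ 1.
-- t = r + 1 encodes the empty sum (m = 0).  Only the values a i for
-- t ≤ i ≤ r are relevant.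
IsRBinRep : ℕ → ℕ → ℕ → (ℕ → ℕ) → Set
IsRBinRep r m t a =
  (1 ≤ t) × (t ≤ suc r)
  × (∀ i → t ≤ i → i < r → a i < a (suc i))
  × (t ≤ r → t ≤ a t)
  × (m ≡ sumFromTo t r (λ i → a i C i))
  where open import Relation.Binary.PropositionalEquality using (_≡_)

largestA : ℕ → ℕ → ℕ → ℕ
largestA i m zero = zero
largestA i m (suc k) with (suc k) C i ≤? m
... | yes _ = suc k
... | no  _ = largestA i m k

-- Greedy computation of the r-binomial representation of m, as a list of
-- pairs (i , a_i), for i = r, r-1, ..., t.  For i ≥ 1 and C(a,i) ≤ m we
-- have a ≤ m + i, so searching a ≤ m + i suffices.
greedyRep : ℕ → ℕ → List (ℕ × ℕ)
greedyRep zero m = []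
greedyRep (suc i) zero = []
greedyRep (suc i) (suc m) =
  let a = largestA (suc i) (suc m) (suc m + suc i)
  in (suc i , a) ∷ greedyRep i (suc m ∸ (a C suc i))

kappa : ℕ → ℕ → ℤ
kappa r m = + sum (map (λ { (i , a) → a C (i ∸ 1) }) (greedyRep r m)) - + m

minUpTo : (ℕ → ℤ) → ℕ → ℤ
minUpTo f zero = f zero
minUpTo f (suc n) = minUpTo f n ⊓ f (suc n)

kappaStar : ℕ → ℕ → ℤ
kappaStar r m = minUpTo (kappa r) m

-- Peel off the leading term: x = C(A, k+1) + y with y < C(A, k).  Then
-- κ_{k+1}(x) = g_k(A) + κ_k(y) with g_k(A) = C(A,k) − C(A,k+1), while every j < C(A, k+1)
-- has κ_{k+1}(j) ≥ min(0, g_k(A) + 1).  By unimodality of i ↦ C(A, i), g_k(A) ≤ 0 exactly when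
-- A ≥ 2k+1.  So for A ≥ 2k+1 minimality of κ_{k+1} at x reduces to minimality of κ_k at y,
-- whereas for A ≤ 2k one gets κ_{k+1}(x) ≥ 1 > 0 = κ_{k+1}(0).
module Submission where

open import Defs

module Binomial where
  open import Data.Nat
  open import Data.Nat.Properties
  open import Data.Nat.Combinatorics using (_C_; nCk+nC[k+1]≡[n+1]C[k+1])
  open import Data.Nat.Tactic.RingSolver using (solve-∀)
  open import Relation.Nullary using (yes; no)
  open import Relation.Binary.PropositionalEquality

  -- Pascal's recursion, which (unlike _C_) computes by pattern matching.
  binom : ℕ → ℕ → ℕ
  binom n       zero    = 1
  binom zero    (suc k) = 0
  binom (suc n) (suc k) = binom n k + binom n (suc k)

  C≡binom : ∀ n k → n C k ≡ binom n k
  C≡binom n       zero    = refl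
  C≡binom zero    (suc k) = refl
  C≡binom (suc n) (suc k) =
    trans (sym (nCk+nC[k+1]≡[n+1]C[k+1] n k)) (cong₂ _+_ (C≡binom n k) (C≡binom n (suc k)))

  binom-1 : ∀ n → binom n 1 ≡ n
  binom-1 zero    = refl
  binom-1 (suc n) = cong suc (binom-1 n)

  binom-pos : ∀ {n k} → k ≤ n → 0 < binom n k
  binom-pos {k = zero}              _         = s≤s z≤n
  binom-pos {suc n} {suc k} (s≤s k≤n) = ≤-trans (binom-pos k≤n) (m≤m+n _ _)

  binom-monoˡ-≤ : ∀ k {m n} → m ≤ n → binom m k ≤ binom n k
  binom-monoˡ-≤ zero    _ = ≤-refl
  binom-monoˡ-≤ (suc k) {zero}  _ = z≤n
  binom-monoˡ-≤ (suc k) {suc m} {suc n} (s≤s m≤n) =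
    +-mono-≤ (binom-monoˡ-≤ k m≤n) (binom-monoˡ-≤ (suc k) m≤n)

  binom-growth : ∀ n k → n ≤ binom n (suc k) + k
  binom-growth zero    k = z≤n
  binom-growth (suc n) k with k ≤? n
  ... | yes k≤n = begin
    suc n                               ≤⟨ +-mono-≤ (binom-pos k≤n) (binom-growth n k) ⟩
    binom n k + (binom n (suc k) + k)   ≡⟨ +-assoc (binom n k) _ k ⟨
    binom (suc n) (suc k) + k           ∎
    where open ≤-Reasoning
  ... | no k≰n = ≤-trans (≰⇒> k≰n) (m≤n+m k _)

  binom-absorb : ∀ n k → suc k * binom (suc n) (suc k) ≡ suc n * binom n k
  binom-absorb zero    zero    = refl
  binom-absorb zero    (suc k) = *-zeroʳ (suc (suc k))
  binom-absorb (suc n) zero    =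
    trans (+-identityʳ _) (trans (cong suc (binom-1 (suc n))) (sym (*-identityʳ (suc (suc n)))))
  binom-absorb (suc n) (suc k) = begin
    suc (suc k) * (X + Y)                   ≡⟨ *-distribˡ-+ (suc (suc k)) X Y ⟩
    X + suc k * X + suc (suc k) * Y         ≡⟨ +-assoc X _ _ ⟩
    X + (suc k * X + suc (suc k) * Y)
      ≡⟨ cong₂ (λ u v → X + (u + v)) (binom-absorb n k) (binom-absorb n (suc k)) ⟩
    X + (suc n * binom n k + suc n * binom n (suc k))
      ≡⟨ cong (X +_) (*-distribˡ-+ (suc n) (binom n k) (binom n (suc k))) ⟨
    suc (suc n) * X                         ∎
    where
    open ≡-Reasoning
    X : ℕ
    X = binom (suc n) (suc k)
    Y : ℕ
    Y = binom (suc n) (suc (suc k))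

  -- (k+1)·C(n,k+1) = (n−k)·C(n,k), with the subtraction moved to the left.
  binom-ratio : ∀ n k → suc k * binom n (suc k) + k * binom n k ≡ n * binom n k
  binom-ratio zero    zero    = refl
  binom-ratio zero    (suc k) = trans (cong (_+ suc k * 0) (*-zeroʳ (suc (suc k)))) (*-zeroʳ (suc k))
  binom-ratio (suc n) zero    = trans (+-identityʳ _) (binom-absorb n zero)
  binom-ratio (suc n) (suc k) = begin
    suc (suc k) * binom (suc n) (suc (suc k)) + suc k * binom (suc n) (suc k)
      ≡⟨ cong₂ _+_ (binom-absorb n (suc k)) (binom-absorb n k) ⟩
    suc n * binom n (suc k) + suc n * binom n k
      ≡⟨ +-comm (suc n * binom n (suc k)) _ ⟩
    suc n * binom n k + suc n * binom n (suc k)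
      ≡⟨ *-distribˡ-+ (suc n) (binom n k) _ ⟨
    suc n * (binom n k + binom n (suc k)) ∎
    where open ≡-Reasoning

  private
    *-double-suc : ∀ k x → suc (k + k) * x ≡ suc k * x + k * x
    *-double-suc = solve-∀

    *-double-suc-suc : ∀ k x → suc (suc (k + k)) * x ≡ suc k * x + x + k * x
    *-double-suc-suc = solve-∀

  binom-suc≤binom : ∀ n k → n ≤ suc (k + k) → binom n (suc k) ≤ binom n k
  binom-suc≤binom n k n≤ = *-cancelˡ-≤ (suc k) (+-cancelʳ-≤ (k * X) _ _ (begin
    suc k * binom n (suc k) + k * X ≡⟨ binom-ratio n k ⟩
    n * X                           ≤⟨ *-monoˡ-≤ X n≤ ⟩
    suc (k + k) * X                 ≡⟨ *-double-suc k X ⟩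
    suc k * X + k * X               ∎))
    where
    open ≤-Reasoning
    X : ℕ
    X = binom n k

  binom-suc<binom : ∀ n k → k ≤ n → n ≤ k + k → binom n (suc k) < binom n k
  binom-suc<binom n k k≤n n≤ = *-cancelˡ-< (suc k) _ _ (begin-strict
    suc k * binom n (suc k) ≤⟨ +-cancelʳ-≤ (k * X) _ _ (begin
      suc k * binom n (suc k) + k * X ≡⟨ binom-ratio n k ⟩
      n * X                           ≤⟨ *-monoˡ-≤ X n≤ ⟩
      (k + k) * X                     ≡⟨ *-distribʳ-+ X k k ⟩
      k * X + k * X                   ∎) ⟩
    k * X                   <⟨ +-monoˡ-< (k * X) (binom-pos k≤n) ⟩
    suc k * X               ∎)
    where
    open ≤-Reasoning
    X : ℕ
    X = binom n k

  binom≤binom-suc : ∀ n k → suc (k + k) ≤ n → binom n k ≤ binom n (suc k)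
  binom≤binom-suc n k ≤n = *-cancelˡ-≤ (suc k) (+-cancelʳ-≤ (k * X) _ _ (begin
    suc k * X + k * X               ≡⟨ *-double-suc k X ⟨
    suc (k + k) * X                 ≤⟨ *-monoˡ-≤ X ≤n ⟩
    n * X                           ≡⟨ binom-ratio n k ⟨
    suc k * binom n (suc k) + k * X ∎))
    where
    open ≤-Reasoning
    X : ℕ
    X = binom n k

  binom<binom-suc : ∀ n k → suc (suc (k + k)) ≤ n → binom n k < binom n (suc k)
  binom<binom-suc n k ≤n = *-cancelˡ-< (suc k) _ _ (begin-strict
    suc k * X     <⟨ m<m+n (suc k * X) (binom-pos k≤n) ⟩
    suc k * X + X ≤⟨ +-cancelʳ-≤ (k * X) _ _ (begin
      suc k * X + X + k * X           ≡⟨ *-double-suc-suc k X ⟨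
      suc (suc (k + k)) * X           ≤⟨ *-monoˡ-≤ X ≤n ⟩
      n * X                           ≡⟨ binom-ratio n k ⟨
      suc k * binom n (suc k) + k * X ∎) ⟩
    suc k * binom n (suc k) ∎)
    where
    open ≤-Reasoning
    X : ℕ
    X = binom n k
    k≤n : k ≤ n
    k≤n = ≤-trans (m≤m+n k k) (≤-trans (n≤1+n _) (≤-trans (n≤1+n _) ≤n))

module Gap where
  open Binomial
  open import Data.Nat as ℕ using (ℕ; zero; suc; z≤n; s≤s)
  import Data.Nat.Properties as ℕ
  open import Data.Integer hiding (suc)
  open import Data.Integer.Properties
  open import Data.Integer.Tactic.RingSolver using (solve-∀)
  open import Data.Sum using (inj₁; inj₂)
  open import Relation.Nullary using (yes; no)
  open import Relation.Binary.PropositionalEquality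

  gap : ℕ → ℕ → ℤ
  gap k b = + binom b k - + binom b (suc k)

  private
    +m-+n≡+[m∸n] : ∀ {m n} → n ℕ.≤ m → + m - + n ≡ + (m ℕ.∸ n)
    +m-+n≡+[m∸n] {m} {n} n≤m = trans (m-n≡m⊖n m n) (⊖-≥ n≤m)

    m<n⇒+m-+n≤-1 : ∀ {m n} → m ℕ.< n → + m - + n ≤ -1ℤ
    m<n⇒+m-+n≤-1 {m} {n} m<n rewrite m-n≡m⊖n m n | ⊖-< m<n = neg-mono-≤ (+≤+ (ℕ.m<n⇒0<n∸m m<n))

  gap-nonNeg : ∀ k b → b ℕ.≤ suc (k ℕ.+ k) → 0ℤ ≤ gap k b
  gap-nonNeg k b b≤ rewrite +m-+n≡+[m∸n] (binom-suc≤binom b k b≤) = +≤+ z≤n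

  gap-pos : ∀ k b → k ℕ.≤ b → b ℕ.≤ k ℕ.+ k → 1ℤ ≤ gap k b
  gap-pos k b k≤b b≤ rewrite +m-+n≡+[m∸n] (ℕ.<⇒≤ (binom-suc<binom b k k≤b b≤)) =
    +≤+ (ℕ.m<n⇒0<n∸m (binom-suc<binom b k k≤b b≤))

  gap-nonPos : ∀ k b → suc (k ℕ.+ k) ℕ.≤ b → gap k b ≤ 0ℤ
  gap-nonPos k b ≤b = i≤j⇒i-j≤0 (+≤+ (binom≤binom-suc b k ≤b))

  gap-≤-1 : ∀ k b → suc (suc (k ℕ.+ k)) ℕ.≤ b → gap k b ≤ -1ℤ
  gap-≤-1 k b ≤b = m<n⇒+m-+n≤-1 (binom<binom-suc b k ≤b)

  gap-pascal : ∀ k b → gap (suc k) (suc b) ≡ gap (suc k) b + gap k b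
  gap-pascal k b
    rewrite pos-+ (binom b k) (binom b (suc k)) | pos-+ (binom b (suc k)) (binom b (suc (suc k))) =
    shape (+ binom b k) (+ binom b (suc k)) (+ binom b (suc (suc k)))
    where
    shape : ∀ x y z → (x + y) - (y + z) ≡ (y - z) + (x - y)
    shape = solve-∀

  gap-zero-suc : ∀ b → gap 0 (suc b) + 1ℤ ≡ gap 0 b
  gap-zero-suc b rewrite pos-+ 1 (binom b 1) = shape (+ binom b 1)
    where
    shape : ∀ y → 1ℤ - (1ℤ + y) + 1ℤ ≡ 1ℤ - y
    shape = solve-∀

  private
    +-nonPos-≤ : ∀ x {y} → y ≤ 0ℤ → x + y ≤ x
    +-nonPos-≤ x y≤0 = ≤-trans (+-monoʳ-≤ x y≤0) (≤-reflexive (+-identityʳ x))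

  gap-step : ∀ k b → k ℕ.+ k ℕ.≤ suc b → gap k (suc b) ≤ gap k b
  gap-step zero    b _ = ≤-trans (i≤i+j (gap 0 (suc b)) 1ℤ) (≤-reflexive (gap-zero-suc b))
  gap-step (suc j) b (s≤s ≤b) rewrite gap-pascal j b =
    +-nonPos-≤ (gap (suc j) b) (gap-nonPos j b (subst (ℕ._≤ b) (ℕ.+-suc j j) ≤b))

  gap-step-strict : ∀ k b → k ℕ.+ k ℕ.≤ b → gap k (suc b) + 1ℤ ≤ gap k b
  gap-step-strict zero    b _ = ≤-reflexive (gap-zero-suc b)
  gap-step-strict (suc j) b ≤b rewrite gap-pascal j b | +-assoc (gap (suc j) b) (gap j b) 1ℤ =
    +-nonPos-≤ (gap (suc j) b) (+-monoˡ-≤ 1ℤ (gap-≤-1 j b (subst (ℕ._≤ b) (cong suc (ℕ.+-suc j j)) ≤b)))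

  gap-antitone : ∀ k {b c} → k ℕ.+ k ℕ.≤ suc b → b ℕ.≤ c → gap k c ≤ gap k b
  gap-antitone k {c = zero}  _  z≤n = ≤-refl
  gap-antitone k {c = suc c} kk b≤ with ℕ.m≤n⇒m<n∨m≡n b≤
  ... | inj₂ refl      = ≤-refl
  ... | inj₁ (s≤s b≤c) = ≤-trans (gap-step k c (ℕ.≤-trans kk (s≤s b≤c))) (gap-antitone k kk b≤c)

  gap-strictAntitone : ∀ k {b c} → k ℕ.+ k ℕ.≤ b → b ℕ.< c → gap k c + 1ℤ ≤ gap k b
  gap-strictAntitone k {b} kk b<c =
    ≤-trans (+-monoˡ-≤ 1ℤ (gap-antitone k (ℕ.≤-trans kk (ℕ.≤-trans (ℕ.n≤1+n b) (ℕ.n≤1+n (suc b)))) b<c))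
            (gap-step-strict k b kk)

  gap-+-⊓ : ∀ j A → gap (suc j) A + 0ℤ ⊓ (gap j A + 1ℤ) ≡ gap (suc j) A ⊓ (gap (suc j) (suc A) + 1ℤ)
  gap-+-⊓ j A = begin
    g + 0ℤ ⊓ (gap j A + 1ℤ)           ≡⟨ mono-≤-distrib-⊓ (+-monoʳ-≤ g) 0ℤ (gap j A + 1ℤ) ⟩
    (g + 0ℤ) ⊓ (g + (gap j A + 1ℤ))   ≡⟨ cong₂ _⊓_ (+-identityʳ g) (sym (+-assoc g (gap j A) 1ℤ)) ⟩
    g ⊓ (g + gap j A + 1ℤ)            ≡⟨ cong (λ x → g ⊓ (x + 1ℤ)) (gap-pascal j A) ⟨
    g ⊓ (gap (suc j) (suc A) + 1ℤ)    ∎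
    where
    open ≡-Reasoning
    g : ℤ
    g = gap (suc j) A

  ⊓-gap-lowerBound : ∀ j {A a} → A ℕ.< a →
                     0ℤ ⊓ (gap (suc j) a + 1ℤ) ≤ gap (suc j) A ⊓ (gap (suc j) (suc A) + 1ℤ)
  ⊓-gap-lowerBound j {A} A<a with A ℕ.≤? j ℕ.+ suc j
  ... | yes A≤ = ≤-trans (i⊓j≤i 0ℤ _) (⊓-glb
    (gap-nonNeg (suc j) A (ℕ.≤-trans A≤ (ℕ.≤-trans (ℕ.n≤1+n _) (ℕ.n≤1+n _))))
    (≤-trans (gap-nonNeg (suc j) (suc A) (s≤s (ℕ.m≤n⇒m≤1+n A≤))) (i≤i+j _ 1ℤ)))
  ... | no A≰ = ≤-trans (i⊓j≤j 0ℤ _) (⊓-glb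
    (gap-strictAntitone (suc j) (ℕ.≰⇒> A≰) A<a)
    (+-monoˡ-≤ 1ℤ (gap-antitone (suc j) {suc A}
      (ℕ.≤-trans (ℕ.≰⇒> A≰) (ℕ.≤-trans (ℕ.n≤1+n A) (ℕ.n≤1+n _))) A<a)))

  ⊓-gap-pos : ∀ j {A} → suc j ℕ.≤ A → A ℕ.≤ suc j ℕ.+ suc j →
              1ℤ ≤ gap (suc j) A ⊓ (gap (suc j) (suc A) + 1ℤ)
  ⊓-gap-pos j {A} j<A A≤ = ⊓-glb (gap-pos (suc j) A j<A A≤)
    (+-monoˡ-≤ 1ℤ (gap-nonNeg (suc j) (suc A) (s≤s A≤)))

module Greedy where
  open Binomial
  open Gap using (gap)
  open import Data.Nat
  open import Data.Nat.Properties
  open import Data.Nat.Combinatorics using (_C_)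
  open import Data.Integer as ℤ using (+_; 0ℤ)
  open import Data.Integer.Properties using (pos-+)
  open import Data.Integer.Tactic.RingSolver using (solve-∀)
  open import Data.Product using (∃-syntax; _×_; _,_)
  open import Data.Sum using (inj₁; inj₂)
  open import Relation.Nullary using (yes; no; contradiction)
  open import Relation.Binary.PropositionalEquality

  largestA-≡ : ∀ i m n A → A ≤ n → binom A i ≤ m → (∀ b → A < b → m < binom b i) → largestA i m n ≡ A
  largestA-≡ i m zero    A z≤n _ _ = refl
  largestA-≡ i m (suc n) A A≤ lo hi with suc n C i ≤? m | m≤n⇒m<n∨m≡n A≤
  ... | yes le | inj₁ A<n = contradiction (subst (_≤ m) (C≡binom (suc n) i) le) (<⇒≱ (hi (suc n) A<n))
  ... | yes _  | inj₂ A≡n = sym A≡n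
  ... | no _   | inj₁ A<n = largestA-≡ i m n A (≤-pred A<n) lo hi
  ... | no nle | inj₂ refl = contradiction (subst (_≤ m) (sym (C≡binom (suc n) i)) lo) nle

  crossing-point : ∀ (f : ℕ → ℕ) n x → f 0 ≤ x → x < f n → ∃[ A ] f A ≤ x × x < f (suc A)
  crossing-point f zero    x f0≤x x<f0 = contradiction f0≤x (<⇒≱ x<f0)
  crossing-point f (suc n) x f0≤x x<fn with x <? f n
  ... | yes x<f = crossing-point f n x f0≤x x<f
  ... | no x≮f  = n , ≮⇒≥ x≮f , x<fn

  top-coefficient : ∀ k x → ∃[ A ] binom A (suc k) ≤ x × x < binom (suc A) (suc k)
  top-coefficient k x = crossing-point (λ A → binom A (suc k)) (x + suc k) x z≤n x<
    where
    x< : x < binom (x + suc k) (suc k)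
    x< = +-cancelʳ-≤ k _ _ (subst (_≤ binom (x + suc k) (suc k) + k) (+-suc x k) (binom-growth (x + suc k) k))

  kappa-zero : ∀ k → kappa k 0 ≡ 0ℤ
  kappa-zero zero    = refl
  kappa-zero (suc k) = refl

  private
    minus-interchange : ∀ p s c y n → c + y ≡ n →
                     + (p + s) ℤ.- + n ≡ (+ p ℤ.- + c) ℤ.+ (+ s ℤ.- + y)
    minus-interchange p s c y .(c + y) refl rewrite pos-+ p s | pos-+ c y =
      shape (+ p) (+ s) (+ c) (+ y)
      where
      shape : ∀ p s c y → (p ℤ.+ s) ℤ.- (c ℤ.+ y) ≡ (p ℤ.- c) ℤ.+ (s ℤ.- y)
      shape = solve-∀

  kappa-suc : ∀ k A x → 0 < x → binom A (suc k) ≤ x → x < binom (suc A) (suc k) →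
              kappa (suc k) x ≡ gap k A ℤ.+ kappa k (x ∸ binom A (suc k))
  kappa-suc k A (suc x) _ lo hi = begin
    kappa (suc k) (suc x)
      ≡⟨ minus-interchange (a C k) _ (a C suc k) _ _ (m+[n∸m]≡n (subst (_≤ suc x) (sym (a-≡ (suc k))) lo)) ⟩
    (+ (a C k) ℤ.- + (a C suc k)) ℤ.+ kappa k (suc x ∸ a C suc k)
      ≡⟨ cong₂ (λ u v → (+ u ℤ.- + v) ℤ.+ kappa k (suc x ∸ v)) (a-≡ k) (a-≡ (suc k)) ⟩
    gap k A ℤ.+ kappa k (suc x ∸ binom A (suc k)) ∎
    where
    open ≡-Reasoning
    a : ℕ
    a = largestA (suc k) (suc x) (suc x + suc k)
    a≡A : a ≡ A
    a≡A = largestA-≡ (suc k) (suc x) (suc x + suc k) A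
      (≤-trans (binom-growth A k) (+-mono-≤ lo (n≤1+n k))) lo (λ b A<b → <-≤-trans hi (binom-monoˡ-≤ (suc k) A<b))
    a-≡ : ∀ i → a C i ≡ binom A i
    a-≡ i = trans (cong (_C i) a≡A) (C≡binom A i)

module Representation where
  open Binomial
  open import Data.Nat
  open import Data.Nat.Properties
  open import Data.Nat.Combinatorics using (_C_)
  open import Data.List using ([]; _∷_; _++_; applyUpTo; map)
  open import Data.List.Properties using (applyUpTo-∷ʳ; map-++)
  open import Data.Nat.ListAction using (sum)
  open import Data.Nat.ListAction.Properties using (sum-++)
  open import Data.Product using (_×_; _,_)
  open import Data.Sum using (inj₁; inj₂)
  open import Relation.Nullary using (¬_; yes; no; contradiction)
  open import Relation.Binary.PropositionalEquality

  sumFromTo-empty : ∀ r f → sumFromTo (suc r) r f ≡ 0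
  sumFromTo-empty r f rewrite n∸n≡0 r = refl

  sumFromTo-suc : ∀ t k f → t ≤ suc k → sumFromTo t (suc k) f ≡ f (suc k) + sumFromTo t k f
  sumFromTo-suc t k f t≤ = begin
    sum (map f (applyUpTo g (suc (suc k) ∸ t)))  ≡⟨ cong (λ l → sum (map f (applyUpTo g l))) (+-∸-assoc 1 t≤) ⟩
    sum (map f (applyUpTo g (suc n)))            ≡⟨ cong (λ l → sum (map f l)) (applyUpTo-∷ʳ g n) ⟨
    sum (map f (applyUpTo g n ++ g n ∷ [])) ≡⟨ cong sum (map-++ f (applyUpTo g n) (g n ∷ [])) ⟩
    sum (map f (applyUpTo g n) ++ f (g n) ∷ []) ≡⟨ sum-++ (map f (applyUpTo g n)) (f (g n) ∷ []) ⟩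
    sumFromTo t k f + (f (g n) + 0)              ≡⟨ cong (λ z → sumFromTo t k f + (f z + 0)) (m+[n∸m]≡n t≤) ⟩
    sumFromTo t k f + (f (suc k) + 0)            ≡⟨ +-comm _ (f (suc k) + 0) ⟩
    f (suc k) + 0 + sumFromTo t k f              ≡⟨ cong (_+ sumFromTo t k f) (+-identityʳ (f (suc k))) ⟩
    f (suc k) + sumFromTo t k f                  ∎
    where
    open ≡-Reasoning
    g : ℕ → ℕ
    g j = t + j
    n : ℕ
    n = suc k ∸ t

  rep-empty : ∀ {r m t a} → IsRBinRep r m t a → ¬ t ≤ r → m ≡ 0
  rep-empty {r} {a = a} (_ , t≤1+r , _ , _ , m≡) t≰r with ≤-antisym t≤1+r (≰⇒> t≰r)
  ... | refl = trans m≡ (sumFromTo-empty r (λ i → a i C i))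

  rep-top : ∀ {k m t a} → IsRBinRep (suc k) m t a → t ≤ suc k →
            IsRBinRep k (sumFromTo t k (λ i → a i C i)) t a ×
            m ≡ binom (a (suc k)) (suc k) + sumFromTo t k (λ i → a i C i)
  rep-top {k} {t = t} {a} (1≤t , _ , inc , base , m≡) t≤ =
    (1≤t , t≤ , (λ i t≤i i<k → inc i t≤i (m≤n⇒m≤1+n i<k)) , (λ t≤k → base (m≤n⇒m≤1+n t≤k)) , refl) ,
    trans m≡ (trans (sumFromTo-suc t k f t≤) (cong (_+ sumFromTo t k f) (C≡binom (a (suc k)) (suc k))))
    where
    f : ℕ → ℕ
    f i = a i C i

  rep-index≤coeff : ∀ {r m t a} → IsRBinRep r m t a → ∀ {i} → t ≤ i → i ≤ r → i ≤ a i
  rep-index≤coeff (1≤t , _) {zero} t≤0 _ = contradiction (≤-trans 1≤t t≤0) λ ()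
  rep-index≤coeff R@(_ , _ , inc , base , _) {suc i} t≤ i<r with m≤n⇒m<n∨m≡n t≤
  ... | inj₂ refl  = base i<r
  ... | inj₁ t≤i   =
    ≤-trans (s≤s (rep-index≤coeff R (≤-pred t≤i) (≤-trans (n≤1+n i) i<r))) (inc i (≤-pred t≤i) i<r)

  rep-<-binom : ∀ {r m t a} → IsRBinRep r m t a → ∀ {b} → r ≤ b → (t ≤ r → a r < b) → m < binom b r
  rep-<-binom {r} {t = t} R r≤b top with t ≤? r
  rep-<-binom R r≤b top | no t≰r rewrite rep-empty R t≰r = binom-pos r≤b
  rep-<-binom {zero} (1≤t , _) _ _ | yes t≤0 = contradiction (≤-trans 1≤t t≤0) λ ()
  rep-<-binom {suc k} {t = t} {a} R@(_ , _ , inc , _) {b} r≤b top | yes t≤ with rep-top R t≤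
  ... | R′ , refl = begin-strict
    binom A (suc k) + m′ <⟨ +-monoʳ-< (binom A (suc k)) m′< ⟩
    binom A (suc k) + binom A k ≡⟨ +-comm (binom A (suc k)) _ ⟩
    binom (suc A) (suc k) ≤⟨ binom-monoˡ-≤ (suc k) (top t≤) ⟩
    binom b (suc k) ∎
    where
    open ≤-Reasoning
    A : ℕ
    A = a (suc k)
    m′ : ℕ
    m′ = sumFromTo t k (λ i → a i C i)
    m′< : m′ < binom A k
    m′< = rep-<-binom R′ (≤-trans (n≤1+n k) (rep-index≤coeff R t≤ ≤-refl)) (λ t≤k → inc k t≤k (n<1+n k))

module Minimality where
  open Binomial
  open Gap
  open Greedy
  open Representation
  open import Data.Nat as ℕ using (ℕ; zero; suc; z≤n; s≤s; _∸_; _*_)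
  import Data.Nat.Properties as ℕ
  open import Data.Integer hiding (suc; _*_)
  open import Data.Nat.Combinatorics using (_C_)
  open import Data.Integer.Properties
  open import Data.Integer.Tactic.RingSolver using (solve-∀)
  open import Data.Product using (_×_; _,_; uncurry)
  open import Data.Product.Function.NonDependent.Propositional using (_×-⇔_)
  open import Data.Sum using (inj₁; inj₂)
  open import Function.Bundles using (_⇔_; mk⇔)
  import Function.Properties.Equivalence as ⇔
  open import Relation.Nullary using (yes; no; contradiction)
  open import Relation.Binary.PropositionalEquality

  AttainsMin : (ℕ → ℤ) → ℕ → Set
  AttainsMin f m = ∀ j → j ℕ.≤ m → f m ≤ f j

  attainsMin-zero : ∀ f → AttainsMin f 0
  attainsMin-zero f zero z≤n = ≤-refl

  minUpTo-≤ : ∀ f {m j} → j ℕ.≤ m → minUpTo f m ≤ f j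
  minUpTo-≤ f {zero}  z≤n = ≤-refl
  minUpTo-≤ f {suc m} j≤ with ℕ.m≤n⇒m<n∨m≡n j≤
  ... | inj₂ refl = i⊓j≤j _ _
  ... | inj₁ j<   = ≤-trans (i⊓j≤i _ _) (minUpTo-≤ f (ℕ.≤-pred j<))

  minUpTo-glb : ∀ f m {c} → (∀ j → j ℕ.≤ m → c ≤ f j) → c ≤ minUpTo f m
  minUpTo-glb f zero    c≤ = c≤ 0 z≤n
  minUpTo-glb f (suc m) c≤ =
    ⊓-glb (minUpTo-glb f m (λ j j≤ → c≤ j (ℕ.m≤n⇒m≤1+n j≤))) (c≤ (suc m) ℕ.≤-refl)

  ≡minUpTo⇔attainsMin : ∀ f m → (f m ≡ minUpTo f m) ⇔ AttainsMin f m
  ≡minUpTo⇔attainsMin f m = mk⇔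
    (λ eq j j≤ → subst (_≤ f j) (sym eq) (minUpTo-≤ f j≤))
    (λ min → ≤-antisym (minUpTo-glb f m min) (minUpTo-≤ f ℕ.≤-refl))

  kappa-split : ∀ k {A y} → suc k ℕ.≤ A → y ℕ.< binom A k →
                kappa (suc k) (binom A (suc k) ℕ.+ y) ≡ gap k A + kappa k y
  kappa-split k {A} {y} k<A y< = begin
    kappa (suc k) (c ℕ.+ y)                   ≡⟨ kappa-suc k A (c ℕ.+ y) 0<c+y (ℕ.m≤m+n c y) c+y< ⟩
    gap k A + kappa k (c ℕ.+ y ∸ c)           ≡⟨ cong (λ z → gap k A + kappa k z) (ℕ.m+n∸m≡n c y) ⟩
    gap k A + kappa k y                       ∎
    where
    open ≡-Reasoning
    c : ℕ
    c = binom A (suc k)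
    0<c+y : 0 ℕ.< c ℕ.+ y
    0<c+y = ℕ.≤-trans (binom-pos k<A) (ℕ.m≤m+n c y)
    c+y< : c ℕ.+ y ℕ.< binom (suc A) (suc k)
    c+y< = subst (c ℕ.+ y ℕ.<_) (ℕ.+-comm c (binom A k)) (ℕ.+-monoʳ-< c y<)

  mutual
    kappa-lowerBound : ∀ k a x → x ℕ.< binom a (suc k) → 0ℤ ⊓ (gap k a + 1ℤ) ≤ kappa (suc k) x
    kappa-lowerBound k a zero    _  = i⊓j≤i 0ℤ _
    kappa-lowerBound k a (suc x) x< with top-coefficient k (suc x)
    ... | A , lo , hi = begin
      0ℤ ⊓ (gap k a + 1ℤ)                         ≤⟨ gap-+-kappa-lowerBound k A<a rest< ⟩
      gap k A + kappa k (suc x ∸ binom A (suc k)) ≡⟨ kappa-suc k A (suc x) (s≤s z≤n) lo hi ⟨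
      kappa (suc k) (suc x)                       ∎
      where
      open ≤-Reasoning
      A<a : A ℕ.< a
      A<a = ℕ.≰⇒> (λ a≤A → ℕ.<⇒≱ x< (ℕ.≤-trans (binom-monoˡ-≤ (suc k) a≤A) lo))
      rest< : suc x ∸ binom A (suc k) ℕ.< binom A k
      rest< = subst (suc x ∸ binom A (suc k) ℕ.<_) (ℕ.m+n∸n≡m (binom A k) (binom A (suc k)))
                    (ℕ.∸-monoˡ-< hi lo)

    gap-+-kappa-lowerBound : ∀ k {A a y} → A ℕ.< a → y ℕ.< binom A k →
                             0ℤ ⊓ (gap k a + 1ℤ) ≤ gap k A + kappa k y
    gap-+-kappa-lowerBound zero {A} {a} {zero} A<a _ = begin
      0ℤ ⊓ (gap 0 a + 1ℤ) ≤⟨ i⊓j≤j 0ℤ _ ⟩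
      gap 0 a + 1ℤ        ≤⟨ gap-strictAntitone 0 z≤n A<a ⟩
      gap 0 A             ≡⟨ +-identityʳ (gap 0 A) ⟨
      gap 0 A + 0ℤ        ∎
      where open ≤-Reasoning
    gap-+-kappa-lowerBound zero {y = suc y} _ (s≤s ())
    gap-+-kappa-lowerBound (suc j) {A} {a} {y} A<a y< = begin
      0ℤ ⊓ (gap (suc j) a + 1ℤ)                  ≤⟨ ⊓-gap-lowerBound j A<a ⟩
      gap (suc j) A ⊓ (gap (suc j) (suc A) + 1ℤ) ≤⟨ gap-+-kappa-suc-lowerBound j {A} y< ⟩
      gap (suc j) A + kappa (suc j) y            ∎
      where open ≤-Reasoning

    gap-+-kappa-suc-lowerBound : ∀ j {A y} → y ℕ.< binom A (suc j) →
      gap (suc j) A ⊓ (gap (suc j) (suc A) + 1ℤ) ≤ gap (suc j) A + kappa (suc j) y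
    gap-+-kappa-suc-lowerBound j {A} {y} y< = begin
      gap (suc j) A ⊓ (gap (suc j) (suc A) + 1ℤ) ≡⟨ gap-+-⊓ j A ⟨
      gap (suc j) A + 0ℤ ⊓ (gap j A + 1ℤ)        ≤⟨ +-monoʳ-≤ (gap (suc j) A) (kappa-lowerBound j A y y<) ⟩
      gap (suc j) A + kappa (suc j) y            ∎
      where open ≤-Reasoning

  private
    +-cancelˡ-≤ : ∀ i {j k} → i + j ≤ i + k → j ≤ k
    +-cancelˡ-≤ i {j} {k} le = subst₂ _≤_ (shape i j) (shape i k) (+-monoʳ-≤ (- i) le)
      where
      shape : ∀ i j → - i + (i + j) ≡ j
      shape = solve-∀

  attainsMin-restrict : ∀ k {A y} → suc k ℕ.≤ A → y ℕ.< binom A k →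
    AttainsMin (kappa (suc k)) (binom A (suc k) ℕ.+ y) → AttainsMin (kappa k) y
  attainsMin-restrict k {A} {y} k<A y< min j j≤y = +-cancelˡ-≤ (gap k A) (begin
    gap k A + kappa k y     ≡⟨ kappa-split k k<A y< ⟨
    kappa (suc k) (c ℕ.+ y) ≤⟨ min (c ℕ.+ j) (ℕ.+-monoʳ-≤ c j≤y) ⟩
    kappa (suc k) (c ℕ.+ j) ≡⟨ kappa-split k k<A (ℕ.≤-<-trans j≤y y<) ⟩
    gap k A + kappa k j     ∎)
    where
    open ≤-Reasoning
    c : ℕ
    c = binom A (suc k)

  attainsMin-top : ∀ k {A y} → suc k ℕ.≤ A → y ℕ.< binom A k →
    AttainsMin (kappa (suc k)) (binom A (suc k) ℕ.+ y) → suc (k ℕ.+ k) ℕ.≤ A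
  attainsMin-top zero    k<A _ _ = k<A
  attainsMin-top (suc j) {A} {y} k<A y< min with A ℕ.≤? suc j ℕ.+ suc j
  ... | no A≰  = ℕ.≰⇒> A≰
  ... | yes A≤ = contradiction 1≤0 λ { (+≤+ ()) }
    where
    open ≤-Reasoning
    1≤0 : 1ℤ ≤ 0ℤ
    1≤0 = begin
      1ℤ                                          ≤⟨ ⊓-gap-pos j (ℕ.<⇒≤ k<A) A≤ ⟩
      gap (suc j) A ⊓ (gap (suc j) (suc A) + 1ℤ)  ≤⟨ gap-+-kappa-suc-lowerBound j {A} y< ⟩
      gap (suc j) A + kappa (suc j) y             ≡⟨ kappa-split (suc j) k<A y< ⟨
      kappa (suc (suc j)) (binom A (suc (suc j)) ℕ.+ y) ≤⟨ min 0 z≤n ⟩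
      0ℤ                                          ∎

  attainsMin-extend : ∀ k {A y} → suc (k ℕ.+ k) ℕ.≤ A → y ℕ.< binom A k →
    AttainsMin (kappa k) y → AttainsMin (kappa (suc k)) (binom A (suc k) ℕ.+ y)
  attainsMin-extend k {A} {y} A≥ y< min j j≤ with binom A (suc k) ℕ.≤? j
  ... | yes c≤j = begin
    kappa (suc k) (c ℕ.+ y)         ≡⟨ kappa-split k k<A y< ⟩
    gap k A + kappa k y             ≤⟨ +-monoʳ-≤ (gap k A) (min (j ∸ c) j∸c≤y) ⟩
    gap k A + kappa k (j ∸ c)       ≡⟨ kappa-split k k<A (ℕ.≤-<-trans j∸c≤y y<) ⟨
    kappa (suc k) (c ℕ.+ (j ∸ c))   ≡⟨ cong (kappa (suc k)) (ℕ.m+[n∸m]≡n c≤j) ⟩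
    kappa (suc k) j                 ∎
    where
    open ≤-Reasoning
    c : ℕ
    c = binom A (suc k)
    k<A : suc k ℕ.≤ A
    k<A = ℕ.≤-trans (s≤s (ℕ.m≤m+n k k)) A≥
    j∸c≤y : j ∸ c ℕ.≤ y
    j∸c≤y = subst (j ∸ c ℕ.≤_) (ℕ.m+n∸m≡n c y) (ℕ.∸-monoˡ-≤ c j≤)
  ... | no c≰j = begin
    kappa (suc k) (c ℕ.+ y)         ≡⟨ kappa-split k k<A y< ⟩
    gap k A + kappa k y             ≤⟨ +-monoʳ-≤ (gap k A) (min 0 z≤n) ⟩
    gap k A + kappa k 0             ≡⟨ trans (cong (λ z → gap k A + z) (kappa-zero k)) (+-identityʳ (gap k A)) ⟩
    gap k A                         ≤⟨ ⊓-glb (gap-nonPos k A A≥) (i≤i+j (gap k A) 1ℤ) ⟩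
    0ℤ ⊓ (gap k A + 1ℤ)             ≤⟨ kappa-lowerBound k A j (ℕ.≰⇒> c≰j) ⟩
    kappa (suc k) j                 ∎
    where
    open ≤-Reasoning
    c : ℕ
    c = binom A (suc k)
    k<A : suc k ℕ.≤ A
    k<A = ℕ.≤-trans (s≤s (ℕ.m≤m+n k k)) A≥

  attainsMin-suc⇔ : ∀ k {A y} → suc k ℕ.≤ A → y ℕ.< binom A k →
    AttainsMin (kappa (suc k)) (binom A (suc k) ℕ.+ y) ⇔ (AttainsMin (kappa k) y × suc (k ℕ.+ k) ℕ.≤ A)
  attainsMin-suc⇔ k k<A y< = mk⇔
    (λ min → attainsMin-restrict k k<A y< min , attainsMin-top k k<A y< min)
    (uncurry λ min A≥ → attainsMin-extend k A≥ y< min)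

  LargeCoefficients : ℕ → ℕ → (ℕ → ℕ) → Set
  LargeCoefficients r t a = ∀ i → t ℕ.≤ i → i ℕ.≤ r → 2 * i ∸ 1 ℕ.≤ a i

  largeCoefficients-suc : ∀ {k t a} → t ℕ.≤ suc k →
    LargeCoefficients (suc k) t a ⇔ (LargeCoefficients k t a × suc (k ℕ.+ k) ℕ.≤ a (suc k))
  largeCoefficients-suc {k} {t} {a} t≤ = mk⇔
    (λ large → (λ i t≤i i≤k → large i t≤i (ℕ.m≤n⇒m≤1+n i≤k)) ,
               subst (ℕ._≤ a (suc k)) 2[1+k]∸1≡ (large (suc k) t≤ ℕ.≤-refl))
    (uncurry extend)
    where
    2[1+k]∸1≡ : 2 * suc k ∸ 1 ≡ suc (k ℕ.+ k)
    2[1+k]∸1≡ rewrite ℕ.+-identityʳ k | ℕ.+-suc k k = refl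
    extend : LargeCoefficients k t a → suc (k ℕ.+ k) ℕ.≤ a (suc k) → LargeCoefficients (suc k) t a
    extend large top i t≤i i≤ with ℕ.m≤n⇒m<n∨m≡n i≤
    ... | inj₁ i<  = large i t≤i (ℕ.≤-pred i<)
    ... | inj₂ refl = subst (ℕ._≤ a (suc k)) (sym 2[1+k]∸1≡) top

  attainsMin⇔largeCoefficients : ∀ r {m t a} → IsRBinRep r m t a →
    AttainsMin (kappa r) m ⇔ LargeCoefficients r t a
  attainsMin⇔largeCoefficients r {t = t} R with t ℕ.≤? r
  ... | no t≰r rewrite rep-empty R t≰r =
    mk⇔ (λ _ i t≤i i≤r → contradiction (ℕ.≤-trans t≤i i≤r) t≰r) (λ _ → attainsMin-zero (kappa r))
  attainsMin⇔largeCoefficients zero    (1≤t , _) | yes t≤0 = contradiction (ℕ.≤-trans 1≤t t≤0) λ ()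
  attainsMin⇔largeCoefficients (suc k) {t = t} {a} R@(_ , _ , inc , _) | yes t≤ with rep-top R t≤
  ... | R′ , refl =
    ⇔.trans (attainsMin-suc⇔ k k<A y<)
      (⇔.trans (attainsMin⇔largeCoefficients k R′ ×-⇔ ⇔.refl) (⇔.sym (largeCoefficients-suc t≤)))
    where
    k<A : suc k ℕ.≤ a (suc k)
    k<A = rep-index≤coeff R t≤ ℕ.≤-refl
    y< : sumFromTo t k (λ i → a i C i) ℕ.< binom (a (suc k)) k
    y< = rep-<-binom R′ (ℕ.≤-trans (ℕ.n≤1+n k) k<A) (λ t≤k → inc k t≤k (ℕ.n<1+n k))

open import Data.Nat using (ℕ; _*_; _∸_; _≤_)
open import Relation.Binary.PropositionalEquality using (_≡_)
open import Function.Bundles using (_⇔_)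
import Function.Properties.Equivalence as ⇔
open Minimality using (≡minUpTo⇔attainsMin; attainsMin⇔largeCoefficients)

theorem2p3 : (r : ℕ) → 1 ≤ r → (m t : ℕ) → (a : ℕ → ℕ) → IsRBinRep r m t a →
    (kappa r m ≡ kappaStar r m) ⇔ (∀ i → t ≤ i → i ≤ r → 2 * i ∸ 1 ≤ a i)
theorem2p3 r _ m t a R =
  ⇔.trans (≡minUpTo⇔attainsMin (kappa r) m) (attainsMin⇔largeCoefficients r R)
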